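{- For every integer $n\geqslant 12$, $\phi(H_n,\lambda)=\lambda\,\phi(H_{n-1},\lambda)-\phi(H_{n-2},\lambda)$.
   Context: All graphs are finite, simple and undirected; $\phi(G,\lambda)=\det(\lambda I-A(G))$ is the characteristic polynomial of the adjacency matrix. For $r\geqslant 2$, $P_r$ is the path with vertices $0,1,\dots,r-1$ (consecutive integers adjacent). For $0<m_1<m_2<r-1$ and positive integers $n_1,n_2$, $P_{n_1,n_2;r}^{m_1,m_2}$ is obtained from $P_r$ by attaching at vertex $m_i$ a pendant path with $n_i$ edges ($i=1,2$). For $n\geqslant 10$, $H_n:=P_{2,2;n-4}^{2,n-7}$, a tree with $n$ vertices. -}

module Defs where

open import Data.Nat using (ℕ; zero; suc; _∸_; _≡ᵇ_; _<ᵇ_; _+_)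
open import Data.Integer using (ℤ; +_; -_) renaming (_+_ to _+ℤ_; _*_ to _*ℤ_)
open import Data.List using (List; []; _∷_; map)
open import Data.Fin using (Fin; zero; suc; toℕ; punchIn; _≟_)
open import Data.Bool using (Bool; true; false; if_then_else_; _∧_; _∨_)
open import Relation.Nullary using (does)
open import Relation.Binary.PropositionalEquality using (_≡_)

-- Polynomials over ℤ in one variable λ, as coefficient lists
-- (lowest degree first).

Poly : Set
Poly = List ℤ

infixl 6 _+P_ _-P_
infixl 7 _*P_

_+P_ : Poly → Poly → Poly
[]      +P q       = q
(a ∷ p) +P []      = a ∷ p
(a ∷ p) +P (b ∷ q) = (a +ℤ b) ∷ (p +P q)

negP : Poly → Poly
negP = map -_

_-P_ : Poly → Poly → Poly
p -P q = p +P negP q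

scaleP : ℤ → Poly → Poly
scaleP a = map (a *ℤ_)

_*P_ : Poly → Poly → Poly
[]      *P q = []
(a ∷ p) *P q = scaleP a q +P ((+ 0) ∷ (p *P q))

X : Poly
X = (+ 0) ∷ (+ 1) ∷ []

oneP : Poly
oneP = (+ 1) ∷ []

coeff : Poly → ℕ → ℤ
coeff []      _       = + 0
coeff (a ∷ p) zero    = a
coeff (a ∷ p) (suc k) = coeff p k

_≈P_ : Poly → Poly → Set
p ≈P q = ∀ k → coeff p k ≡ coeff q k

sumFin : ∀ {n} → (Fin n → Poly) → Poly
sumFin {zero}  f = []
sumFin {suc n} f = f zero +P sumFin (λ j → f (suc j))

alt : ℕ → Poly → Poly
alt zero    p = p
alt (suc k) p = negP (alt k p)

det : ∀ n → (Fin n → Fin n → Poly) → Poly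
det zero    M = oneP
det (suc n) M =
  sumFin (λ j → alt (toℕ j) (M zero j *P det n (λ a b → M (suc a) (punchIn j b))))

record Graph : Set where
  field
    size : ℕ
    adj  : Fin size → Fin size → Bool

constP : Bool → Poly
constP true  = oneP
constP false = []

charMat : (G : Graph) → Fin (Graph.size G) → Fin (Graph.size G) → Poly
charMat G i j = (if does (i ≟ j) then X else []) -P constP (Graph.adj G i j)

φ : Graph → Poly
φ G = det (Graph.size G) (charMat G)

-- P_{n1,n2;r}^{m1,m2}: vertices 0..r-1 form the path P_r; vertices
-- r..r+n1-1 form the pendant path at m1 (m1 ~ r ~ r+1 ~ ... ~ r+n1-1);
-- vertices r+n1..r+n1+n2-1 form the pendant path at m2
-- (m2 ~ r+n1 ~ ... ~ r+n1+n2-1).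

edgeB : ℕ → ℕ → ℕ → ℕ → ℕ → ℕ → ℕ → Bool
edgeB n1 n2 r m1 m2 u v =
     ((suc u ≡ᵇ v) ∧ (v <ᵇ r))
  ∨ ((u ≡ᵇ m1) ∧ (v ≡ᵇ r))
  ∨ ((suc u ≡ᵇ v) ∧ (r <ᵇ v) ∧ (v <ᵇ r + n1))
  ∨ ((u ≡ᵇ m2) ∧ (v ≡ᵇ r + n1))
  ∨ ((suc u ≡ᵇ v) ∧ (r + n1 <ᵇ v) ∧ (v <ᵇ r + n1 + n2))

Pgraph : (n1 n2 r m1 m2 : ℕ) → Graph
Pgraph n1 n2 r m1 m2 = record
  { size = r + n1 + n2
  ; adj  = λ i j → edgeB n1 n2 r m1 m2 (toℕ i) (toℕ j)
                 ∨ edgeB n1 n2 r m1 m2 (toℕ j) (toℕ i)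
  }

-- H_n = P_{2,2;n-4}^{2,n-7}  (meaningful for n ≥ 10)
H : ℕ → Graph
H n = Pgraph 2 2 (n ∸ 4) 2 (n ∸ 7)

-- Schwenk's formula φ(G) = λ φ(G − u) − φ(G − u − w), for a pendant vertex u with neighbour w,
-- is the only graph-theoretic input. Deleting the pendant vertices 0, 1, 7+t, 6+t and 2 of
-- H_{10+t} writes φ(H_{10+t}) as an iterate of (a, b) ↦ λa − b applied to f_{t+1}, f_t and
-- d_{t+1}, the characteristic polynomials of two graphs left at the far end; deleting their end
-- vertex 3 shows that f and d satisfy s_{t+2} = λ s_{t+1} − s_t. As (a, b) ↦ λa − b is linear,
-- the recurrence passes to φ(H_{10+t}).
module Submission where

open import Defs
open import Data.Nat using (ℕ; zero; suc; _+_; _∸_; _<_; _≤_; _≡ᵇ_; _<ᵇ_; s≤s; s≤s⁻¹)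
open import Data.Nat.Properties using (≤-antisym; ≤-trans; +-comm; +-assoc; m≤m+n; m≤n⇒∃[o]m+o≡n; n≮n; m+n≮n; ≡ᵇ⇒≡; <ᵇ⇒<)
open import Data.Bool using (true; false; T; if_then_else_; _∧_; _∨_)
open import Data.Bool.Properties using (T-∨; T-∧; ∨-comm)
open import Data.Sum using (_⊎_; inj₁; inj₂)
open import Function.Bundles using (Equivalence)
open import Data.Integer using (ℤ; 0ℤ; 1ℤ) renaming (_+_ to _+ℤ_; _*_ to _*ℤ_; -_ to -ℤ_)
import Data.Integer.Properties as ℤ
open import Data.Integer.Tactic.RingSolver as ℤ-Solver using ()
open import Data.List as List using (List; []; _∷_; map; _++_; _∷ʳ_; applyUpTo; upTo)
open import Data.List.Properties using (++-assoc; ++-identityʳ; map-++; map-applyUpTo; applyUpTo-∷ʳ)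
open import Data.List.Relation.Unary.All.Properties using (++⁺; applyUpTo⁺₁; applyUpTo⁺₂)
open import Function using (_∘_; id)
open import Data.Fin using (Fin; zero; suc; toℕ; punchIn; _≟_)
open import Data.List.Relation.Unary.All as All using (All; []; _∷_)
import Relation.Binary.Reasoning.Setoid as SetoidReasoning
open import Data.Maybe using (Maybe; just; nothing)
open import Data.Product using (_×_; _,_)
open import Level using (0ℓ)
open import Algebra.Properties.CommutativeSemigroup ℤ.+-commutativeSemigroup using (x∙yz≈y∙xz)
open import Algebra.Bundles using (CommutativeRing)
open import Relation.Binary.PropositionalEquality using (_≡_; _≢_; refl; sym; trans; cong; cong₂; subst; subst₂; module ≡-Reasoning)
open import Data.Unit using (tt)
open import Data.Empty using (⊥-elim)
open import Relation.Nullary using (¬_; does)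
import Tactic.RingSolver.Core.AlmostCommutativeRing as ACR
open import Tactic.RingSolver using (solve-∀)

≈P-refl : ∀ {p} → p ≈P p
≈P-refl k = refl

∷-cong : ∀ {a b p q} → a ≡ b → p ≈P q → (a ∷ p) ≈P (b ∷ q)
∷-cong a≡b p≈q zero    = a≡b
∷-cong a≡b p≈q (suc k) = p≈q k

coeff-+P : ∀ p q k → coeff (p +P q) k ≡ coeff p k +ℤ coeff q k
coeff-+P []      q       k       = sym (ℤ.+-identityˡ _)
coeff-+P (a ∷ p) []      k       = sym (ℤ.+-identityʳ _)
coeff-+P (a ∷ p) (b ∷ q) zero    = refl
coeff-+P (a ∷ p) (b ∷ q) (suc k) = coeff-+P p q k

coeff-negP : ∀ p k → coeff (negP p) k ≡ -ℤ coeff p k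
coeff-negP []      k       = refl
coeff-negP (a ∷ p) zero    = refl
coeff-negP (a ∷ p) (suc k) = coeff-negP p k

coeff-scaleP : ∀ a p k → coeff (scaleP a p) k ≡ a *ℤ coeff p k
coeff-scaleP a []      k       = sym (ℤ.*-zeroʳ a)
coeff-scaleP a (b ∷ p) zero    = refl
coeff-scaleP a (b ∷ p) (suc k) = coeff-scaleP a p k

coeff-*P : ∀ a p q k → coeff ((a ∷ p) *P q) k ≡ a *ℤ coeff q k +ℤ coeff (0ℤ ∷ p *P q) k
coeff-*P a p q k = trans (coeff-+P (scaleP a q) _ k) (cong (_+ℤ _) (coeff-scaleP a q k))

+P-cong : ∀ {p p′ q q′} → p ≈P p′ → q ≈P q′ → (p +P q) ≈P (p′ +P q′)
+P-cong {p} {p′} {q} {q′} p≈p′ q≈q′ k = begin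
  coeff (p +P q) k          ≡⟨ coeff-+P p q k ⟩
  coeff p k +ℤ coeff q k    ≡⟨ cong₂ _+ℤ_ (p≈p′ k) (q≈q′ k) ⟩
  coeff p′ k +ℤ coeff q′ k  ≡⟨ coeff-+P p′ q′ k ⟨
  coeff (p′ +P q′) k        ∎
  where open ≡-Reasoning

negP-cong : ∀ {p q} → p ≈P q → negP p ≈P negP q
negP-cong {p} {q} p≈q k =
  trans (coeff-negP p k) (trans (cong -ℤ_ (p≈q k)) (sym (coeff-negP q k)))

+P-assoc : ∀ p q r → ((p +P q) +P r) ≈P (p +P (q +P r))
+P-assoc p q r k = begin
  coeff ((p +P q) +P r) k                    ≡⟨ coeff-+P (p +P q) r k ⟩
  coeff (p +P q) k +ℤ coeff r k              ≡⟨ cong (_+ℤ coeff r k) (coeff-+P p q k) ⟩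
  (coeff p k +ℤ coeff q k) +ℤ coeff r k      ≡⟨ ℤ.+-assoc (coeff p k) _ _ ⟩
  coeff p k +ℤ (coeff q k +ℤ coeff r k)      ≡⟨ cong (coeff p k +ℤ_) (coeff-+P q r k) ⟨
  coeff p k +ℤ coeff (q +P r) k              ≡⟨ coeff-+P p (q +P r) k ⟨
  coeff (p +P (q +P r)) k                    ∎
  where open ≡-Reasoning

+P-comm : ∀ p q → (p +P q) ≈P (q +P p)
+P-comm p q k =
  trans (coeff-+P p q k) (trans (ℤ.+-comm (coeff p k) _) (sym (coeff-+P q p k)))

+P-identityʳ : ∀ p → (p +P []) ≈P p
+P-identityʳ p k = trans (coeff-+P p [] k) (ℤ.+-identityʳ _)

+P-inverseˡ : ∀ p → (negP p +P p) ≈P []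
+P-inverseˡ p k =
  trans (coeff-+P (negP p) p k) (trans (cong (_+ℤ coeff p k) (coeff-negP p k)) (ℤ.+-inverseˡ (coeff p k)))

+P-inverseʳ : ∀ p → (p +P negP p) ≈P []
+P-inverseʳ p k = trans (+P-comm p (negP p) k) (+P-inverseˡ p k)

*P-zeroʳ : ∀ p → (p *P []) ≈P []
*P-zeroʳ []      k       = refl
*P-zeroʳ (a ∷ p) zero    = refl
*P-zeroʳ (a ∷ p) (suc k) = *P-zeroʳ p k

*P-zeroˡ-≈ : ∀ p q → p ≈P [] → (p *P q) ≈P []
*P-zeroˡ-≈ []      q p≈0 k = refl
*P-zeroˡ-≈ (a ∷ p) q p≈0 k = begin
  coeff ((a ∷ p) *P q) k                   ≡⟨ coeff-*P a p q k ⟩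
  a *ℤ coeff q k +ℤ coeff (0ℤ ∷ p *P q) k  ≡⟨ cong₂ (λ b r → b *ℤ coeff q k +ℤ r) (p≈0 0) (p*q≈0 k) ⟩
  0ℤ *ℤ coeff q k +ℤ 0ℤ                    ≡⟨ cong (_+ℤ 0ℤ) (ℤ.*-zeroˡ (coeff q k)) ⟩
  0ℤ                                       ∎
  where
  open ≡-Reasoning
  p*q≈0 : (0ℤ ∷ p *P q) ≈P []
  p*q≈0 zero    = refl
  p*q≈0 (suc k) = *P-zeroˡ-≈ p q (λ k → p≈0 (suc k)) k

*P-congʳ : ∀ p {q q′} → q ≈P q′ → (p *P q) ≈P (p *P q′)
*P-congʳ []      q≈q′ k = refl
*P-congʳ (a ∷ p) {q} {q′} q≈q′ k = begin
  coeff ((a ∷ p) *P q) k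
    ≡⟨ coeff-*P a p q k ⟩
  a *ℤ coeff q k +ℤ coeff (0ℤ ∷ p *P q) k
    ≡⟨ cong₂ (λ c r → a *ℤ c +ℤ r) (q≈q′ k) (∷-cong {p = p *P q} refl (*P-congʳ p q≈q′) k) ⟩
  a *ℤ coeff q′ k +ℤ coeff (0ℤ ∷ p *P q′) k
    ≡⟨ coeff-*P a p q′ k ⟨
  coeff ((a ∷ p) *P q′) k
    ∎
  where open ≡-Reasoning

*P-congˡ : ∀ {p p′} q → p ≈P p′ → (p *P q) ≈P (p′ *P q)
*P-congˡ {[]}    {p′}     q p≈p′ k = sym (*P-zeroˡ-≈ p′ q (λ k → sym (p≈p′ k)) k)
*P-congˡ {a ∷ p} {[]}     q p≈p′   = *P-zeroˡ-≈ (a ∷ p) q p≈p′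
*P-congˡ {a ∷ p} {a′ ∷ p′} q p≈p′ k = begin
  coeff ((a ∷ p) *P q) k
    ≡⟨ coeff-*P a p q k ⟩
  a *ℤ coeff q k +ℤ coeff (0ℤ ∷ p *P q) k
    ≡⟨ cong₂ (λ b r → b *ℤ coeff q k +ℤ r) (p≈p′ 0)
             (∷-cong {p = p *P q} refl (*P-congˡ {p} {p′} q (λ k → p≈p′ (suc k))) k) ⟩
  a′ *ℤ coeff q k +ℤ coeff (0ℤ ∷ p′ *P q) k
    ≡⟨ coeff-*P a′ p′ q k ⟨
  coeff ((a′ ∷ p′) *P q) k
    ∎
  where open ≡-Reasoning

*P-cong : ∀ {p p′ q q′} → p ≈P p′ → q ≈P q′ → (p *P q) ≈P (p′ *P q′)
*P-cong {p} {p′} {q} p≈p′ q≈q′ k = trans (*P-congˡ {p} {p′} q p≈p′ k) (*P-congʳ p′ q≈q′ k)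

*P-distribʳ : ∀ p q r → ((p +P q) *P r) ≈P ((p *P r) +P (q *P r))
*P-distribʳ []      q       r k = refl
*P-distribʳ (a ∷ p) []      r k = sym (+P-identityʳ ((a ∷ p) *P r) k)
*P-distribʳ (a ∷ p) (b ∷ q) r k = begin
  coeff ((a +ℤ b ∷ p +P q) *P r) k
    ≡⟨ coeff-*P (a +ℤ b) (p +P q) r k ⟩
  (a +ℤ b) *ℤ c +ℤ coeff (0ℤ ∷ (p +P q) *P r) k
    ≡⟨ cong ((a +ℤ b) *ℤ c +ℤ_) (∷-cong {p = (p +P q) *P r} {q = p *P r +P q *P r} refl (*P-distribʳ p q r) k) ⟩
  (a +ℤ b) *ℤ c +ℤ coeff ((0ℤ ∷ p *P r) +P (0ℤ ∷ q *P r)) k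
    ≡⟨ cong ((a +ℤ b) *ℤ c +ℤ_) (coeff-+P (0ℤ ∷ p *P r) (0ℤ ∷ q *P r) k) ⟩
  (a +ℤ b) *ℤ c +ℤ (coeff (0ℤ ∷ p *P r) k +ℤ coeff (0ℤ ∷ q *P r) k)
    ≡⟨ regroup a b c _ _ ⟩
  (a *ℤ c +ℤ coeff (0ℤ ∷ p *P r) k) +ℤ (b *ℤ c +ℤ coeff (0ℤ ∷ q *P r) k)
    ≡⟨ cong₂ _+ℤ_ (coeff-*P a p r k) (coeff-*P b q r k) ⟨
  coeff ((a ∷ p) *P r) k +ℤ coeff ((b ∷ q) *P r) k
    ≡⟨ coeff-+P ((a ∷ p) *P r) _ k ⟨
  coeff (((a ∷ p) *P r) +P ((b ∷ q) *P r)) k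
    ∎
  where
  open ≡-Reasoning
  c = coeff r k
  regroup : ∀ a b c x y → (a +ℤ b) *ℤ c +ℤ (x +ℤ y) ≡ (a *ℤ c +ℤ x) +ℤ (b *ℤ c +ℤ y)
  regroup = ℤ-Solver.solve-∀

*P-∷ʳ : ∀ p b q → (p *P (b ∷ q)) ≈P (scaleP b p +P (0ℤ ∷ p *P q))
*P-∷ʳ []      b q zero    = refl
*P-∷ʳ []      b q (suc k) = refl
*P-∷ʳ (a ∷ p) b q zero    = cong (_+ℤ 0ℤ) (ℤ.*-comm a b)
*P-∷ʳ (a ∷ p) b q (suc k) = begin
  coeff (scaleP a q +P p *P (b ∷ q)) k
    ≡⟨ coeff-+P (scaleP a q) (p *P (b ∷ q)) k ⟩
  coeff (scaleP a q) k +ℤ coeff (p *P (b ∷ q)) k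
    ≡⟨ cong₂ _+ℤ_ (coeff-scaleP a q k) (*P-∷ʳ p b q k) ⟩
  a *ℤ coeff q k +ℤ coeff (scaleP b p +P (0ℤ ∷ p *P q)) k
    ≡⟨ cong (a *ℤ coeff q k +ℤ_) (trans (coeff-+P (scaleP b p) _ k) (cong (_+ℤ _) (coeff-scaleP b p k))) ⟩
  a *ℤ coeff q k +ℤ (b *ℤ coeff p k +ℤ coeff (0ℤ ∷ p *P q) k)
    ≡⟨ x∙yz≈y∙xz (a *ℤ coeff q k) (b *ℤ coeff p k) (coeff (0ℤ ∷ p *P q) k) ⟩
  b *ℤ coeff p k +ℤ (a *ℤ coeff q k +ℤ coeff (0ℤ ∷ p *P q) k)
    ≡⟨ cong₂ _+ℤ_ (coeff-scaleP b p k) (coeff-*P a p q k) ⟨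
  coeff (scaleP b p) k +ℤ coeff ((a ∷ p) *P q) k
    ≡⟨ coeff-+P (scaleP b p) ((a ∷ p) *P q) k ⟨
  coeff (scaleP b p +P (a ∷ p) *P q) k
    ∎
  where open ≡-Reasoning

*P-comm : ∀ p q → (p *P q) ≈P (q *P p)
*P-comm []      q k = sym (*P-zeroʳ q k)
*P-comm (a ∷ p) q k = begin
  coeff ((a ∷ p) *P q) k
    ≡⟨ coeff-*P a p q k ⟩
  a *ℤ coeff q k +ℤ coeff (0ℤ ∷ p *P q) k
    ≡⟨ cong (a *ℤ coeff q k +ℤ_) (∷-cong {p = p *P q} refl (*P-comm p q) k) ⟩
  a *ℤ coeff q k +ℤ coeff (0ℤ ∷ q *P p) k
    ≡⟨ cong (_+ℤ _) (coeff-scaleP a q k) ⟨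
  coeff (scaleP a q) k +ℤ coeff (0ℤ ∷ q *P p) k
    ≡⟨ coeff-+P (scaleP a q) _ k ⟨
  coeff (scaleP a q +P (0ℤ ∷ q *P p)) k
    ≡⟨ *P-∷ʳ q a p k ⟨
  coeff (q *P (a ∷ p)) k
    ∎
  where open ≡-Reasoning

scaleP-*P : ∀ a q r → (scaleP a q *P r) ≈P scaleP a (q *P r)
scaleP-*P a []      r k = refl
scaleP-*P a (b ∷ q) r k = begin
  coeff ((a *ℤ b ∷ scaleP a q) *P r) k
    ≡⟨ coeff-*P (a *ℤ b) (scaleP a q) r k ⟩
  (a *ℤ b) *ℤ coeff r k +ℤ coeff (0ℤ ∷ scaleP a q *P r) k
    ≡⟨ cong ((a *ℤ b) *ℤ coeff r k +ℤ_)
            (∷-cong {p = scaleP a q *P r} {q = scaleP a (q *P r)} (sym (ℤ.*-zeroʳ a)) (scaleP-*P a q r) k) ⟩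
  (a *ℤ b) *ℤ coeff r k +ℤ coeff (scaleP a (0ℤ ∷ q *P r)) k
    ≡⟨ cong ((a *ℤ b) *ℤ coeff r k +ℤ_) (coeff-scaleP a (0ℤ ∷ q *P r) k) ⟩
  (a *ℤ b) *ℤ coeff r k +ℤ a *ℤ coeff (0ℤ ∷ q *P r) k
    ≡⟨ factor a b _ _ ⟩
  a *ℤ (b *ℤ coeff r k +ℤ coeff (0ℤ ∷ q *P r) k)
    ≡⟨ cong (a *ℤ_) (coeff-*P b q r k) ⟨
  a *ℤ coeff ((b ∷ q) *P r) k
    ≡⟨ coeff-scaleP a ((b ∷ q) *P r) k ⟨
  coeff (scaleP a ((b ∷ q) *P r)) k
    ∎
  where
  open ≡-Reasoning
  factor : ∀ a b c x → (a *ℤ b) *ℤ c +ℤ a *ℤ x ≡ a *ℤ (b *ℤ c +ℤ x)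
  factor = ℤ-Solver.solve-∀

*P-assoc : ∀ p q r → ((p *P q) *P r) ≈P (p *P (q *P r))
*P-assoc []      q r k = refl
*P-assoc (a ∷ p) q r k = begin
  coeff ((scaleP a q +P (0ℤ ∷ p *P q)) *P r) k
    ≡⟨ *P-distribʳ (scaleP a q) (0ℤ ∷ p *P q) r k ⟩
  coeff (scaleP a q *P r +P (0ℤ ∷ p *P q) *P r) k
    ≡⟨ coeff-+P (scaleP a q *P r) _ k ⟩
  coeff (scaleP a q *P r) k +ℤ coeff ((0ℤ ∷ p *P q) *P r) k
    ≡⟨ cong₂ _+ℤ_ (trans (scaleP-*P a q r k) (coeff-scaleP a (q *P r) k)) (coeff-*P 0ℤ (p *P q) r k) ⟩
  a *ℤ coeff (q *P r) k +ℤ (0ℤ *ℤ coeff r k +ℤ coeff (0ℤ ∷ (p *P q) *P r) k)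
    ≡⟨ cong (a *ℤ coeff (q *P r) k +ℤ_) (ℤ.+-identityˡ _) ⟩
  a *ℤ coeff (q *P r) k +ℤ coeff (0ℤ ∷ (p *P q) *P r) k
    ≡⟨ cong (a *ℤ coeff (q *P r) k +ℤ_) (∷-cong {p = (p *P q) *P r} refl (*P-assoc p q r) k) ⟩
  a *ℤ coeff (q *P r) k +ℤ coeff (0ℤ ∷ p *P (q *P r)) k
    ≡⟨ coeff-*P a p (q *P r) k ⟨
  coeff ((a ∷ p) *P (q *P r)) k
    ∎
  where open ≡-Reasoning

*P-identityˡ : ∀ p → (oneP *P p) ≈P p
*P-identityˡ p k = begin
  coeff (oneP *P p) k                     ≡⟨ coeff-*P 1ℤ [] p k ⟩
  1ℤ *ℤ coeff p k +ℤ coeff (0ℤ ∷ []) k  ≡⟨ cong₂ _+ℤ_ (ℤ.*-identityˡ (coeff p k)) (zero-coeff k) ⟩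
  coeff p k +ℤ 0ℤ                        ≡⟨ ℤ.+-identityʳ _ ⟩
  coeff p k                               ∎
  where
  open ≡-Reasoning
  zero-coeff : ∀ k → coeff (0ℤ ∷ []) k ≡ 0ℤ
  zero-coeff zero    = refl
  zero-coeff (suc k) = refl

*P-distribˡ : ∀ p q r → (p *P (q +P r)) ≈P ((p *P q) +P (p *P r))
*P-distribˡ p q r k = trans (*P-comm p (q +P r) k)
  (trans (*P-distribʳ q r p k) (+P-cong {q *P p} {p *P q} {r *P p} {p *P r} (*P-comm q p) (*P-comm r p) k))

-- A wrapper around _≈P_ which, unlike the Π-type it unfolds to, lets Agda
-- infer the two polynomials from a proof.
record _≋_ (p q : Poly) : Set where
  constructor mk≋
  field un≋ : p ≈P q
open _≋_ public
infix 4 _≋_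

polyCommutativeRing : CommutativeRing 0ℓ 0ℓ
polyCommutativeRing = record
  { Carrier = Poly ; _≈_ = _≋_ ; _+_ = _+P_ ; _*_ = _*P_ ; -_ = negP ; 0# = [] ; 1# = oneP
  ; isCommutativeRing = record
    { isRing = record
      { +-isAbelianGroup = record
        { isGroup = record
          { isMonoid = record
            { isSemigroup = record
              { isMagma = record
                { isEquivalence = record
                  { refl  = λ {p} → mk≋ (≈P-refl {p})
                  ; sym   = λ (mk≋ p≈q) → mk≋ (λ k → sym (p≈q k))
                  ; trans = λ (mk≋ p≈q) (mk≋ q≈r) → mk≋ (λ k → trans (p≈q k) (q≈r k)) }
                ; ∙-cong = λ {p} {p′} {q} {q′} (mk≋ p≈p′) (mk≋ q≈q′) →
                             mk≋ (+P-cong {p} {p′} {q} {q′} p≈p′ q≈q′) }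
              ; assoc = λ p q r → mk≋ (+P-assoc p q r) }
            ; identity = (λ p → mk≋ (≈P-refl {p})) , (λ p → mk≋ (+P-identityʳ p)) }
          ; inverse = (λ p → mk≋ (+P-inverseˡ p)) , (λ p → mk≋ (+P-inverseʳ p))
          ; ⁻¹-cong = λ {p} {q} (mk≋ p≈q) → mk≋ (negP-cong {p} {q} p≈q) }
        ; comm = λ p q → mk≋ (+P-comm p q) }
      ; *-cong = λ {p} {p′} {q} {q′} (mk≋ p≈p′) (mk≋ q≈q′) → mk≋ (*P-cong {p} {p′} {q} {q′} p≈p′ q≈q′)
      ; *-assoc = λ p q r → mk≋ (*P-assoc p q r)
      ; *-identity = (λ p → mk≋ (*P-identityˡ p)) , (λ p → mk≋ (λ k → trans (*P-comm p oneP k) (*P-identityˡ p k)))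
      ; distrib = (λ p q r → mk≋ (*P-distribˡ p q r)) , (λ p q r → mk≋ (*P-distribʳ q r p)) }
    ; *-comm = λ p q → mk≋ (*P-comm p q) } }

polyRing : ACR.AlmostCommutativeRing 0ℓ 0ℓ
polyRing = ACR.fromCommutativeRing polyCommutativeRing isZero
  where
  isZero : ∀ p → Maybe ([] ≋ p)
  isZero []      = just (mk≋ (≈P-refl {[]}))
  isZero (_ ∷ _) = nothing

open CommutativeRing polyCommutativeRing
  using (+-cong; *-cong; -‿cong) renaming (setoid to polySetoid; refl to ≋-refl; sym to ≋-sym; trans to ≋-trans)

≡⇒≋ : ∀ {p q} → p ≡ q → p ≋ q
≡⇒≋ refl = ≋-refl

-P-cong : ∀ {a a′ b b′} → a ≋ a′ → b ≋ b′ → (a -P b) ≋ (a′ -P b′)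
-P-cong a≋a′ b≋b′ = +-cong a≋a′ (-‿cong b≋b′)

step : Poly → Poly → Poly
step a b = (X *P a) -P b

Recurrent : (ℕ → Poly) → Set
Recurrent s = ∀ t → s (2 + t) ≋ step (s (1 + t)) (s t)

step-cong : ∀ {a a′ b b′} → a ≋ a′ → b ≋ b′ → step a b ≋ step a′ b′
step-cong a≋a′ b≋b′ = -P-cong (*-cong (≋-refl {X}) a≋a′) b≋b′

Recurrent-step : ∀ a b → Recurrent a → Recurrent b → Recurrent (λ t → step (a t) (b t))
Recurrent-step a b rec-a rec-b t = ≋-trans (step-cong (rec-a t) (rec-b t))
  (interchange (a (1 + t)) (a t) (b (1 + t)) (b t))
  where
  interchange : ∀ a₁ a₀ b₁ b₀ →
    ((X *P ((X *P a₁) -P a₀)) -P ((X *P b₁) -P b₀)) ≋ ((X *P ((X *P a₁) -P b₁)) -P ((X *P a₀) -P b₀))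
  interchange = solve-∀ polyRing

Recurrent-suc : ∀ a → Recurrent a → Recurrent (a ∘ suc)
Recurrent-suc a rec-a t = rec-a (suc t)

Matrix : Set
Matrix = ℕ → ℕ → Poly

swap-terms : ∀ p q x y z → ((p *P q) -P ((x *P y) -P negP z)) ≋ negP ((x *P y) -P ((p *P q) -P z))
swap-terms = solve-∀ polyRing

-- Opaque, so that conversion checking never expands a determinant into polynomial arithmetic.
opaque
  -- expandRow A r F cs = Σⱼ (-1)ʲ A r cⱼ F (cs without cⱼ), and minor A rs cs is the
  -- determinant of the submatrix of A with rows rs and columns cs (in these orders),
  -- expanded along its first row; it is 0 when the lengths of rs and cs differ.
  expandRow : Matrix → ℕ → (List ℕ → Poly) → List ℕ → Poly
  expandRow A r F []       = []
  expandRow A r F (c ∷ cs) = (A r c *P F cs) -P expandRow A r (λ ys → F (c ∷ ys)) cs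

  minor : Matrix → List ℕ → List ℕ → Poly
  minor A []       []      = oneP
  minor A []       (_ ∷ _) = []
  minor A (r ∷ rs) cs      = expandRow A r (minor A rs) cs

  expandRow-cong : ∀ A r {F G} → (∀ ys → F ys ≋ G ys) → ∀ cs → expandRow A r F cs ≋ expandRow A r G cs
  expandRow-cong A r F≋G []       = ≋-refl
  expandRow-cong A r F≋G (c ∷ cs) =
    -P-cong (*-cong (≋-refl {A r c}) (F≋G cs)) (expandRow-cong A r (λ ys → F≋G (c ∷ ys)) cs)

  expandRow-linear : ∀ A r k F G cs →
    expandRow A r (λ ys → (k *P F ys) -P G ys) cs ≋ ((k *P expandRow A r F cs) -P expandRow A r G cs)
  expandRow-linear A r k F G []       = ≋-sym (annihilate k)
    where
    annihilate : ∀ k → ((k *P []) -P []) ≋ []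
    annihilate = solve-∀ polyRing
  expandRow-linear A r k F G (c ∷ cs) = begin
    (A r c *P ((k *P F cs) -P G cs)) -P expandRow A r (λ ys → (k *P F (c ∷ ys)) -P G (c ∷ ys)) cs
      ≈⟨ -P-cong ≋-refl (expandRow-linear A r k (λ ys → F (c ∷ ys)) (λ ys → G (c ∷ ys)) cs) ⟩
    (A r c *P ((k *P F cs) -P G cs)) -P ((k *P expandRow A r (λ ys → F (c ∷ ys)) cs) -P expandRow A r (λ ys → G (c ∷ ys)) cs)
      ≈⟨ regroup (A r c) k (F cs) (G cs) _ _ ⟩
    (k *P ((A r c *P F cs) -P expandRow A r (λ ys → F (c ∷ ys)) cs)) -P ((A r c *P G cs) -P expandRow A r (λ ys → G (c ∷ ys)) cs)
      ∎
    where
    open SetoidReasoning polySetoid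
    regroup : ∀ a k f g x y →
      ((a *P ((k *P f) -P g)) -P ((k *P x) -P y)) ≋ ((k *P ((a *P f) -P x)) -P ((a *P g) -P y))
    regroup = solve-∀ polyRing

  expandRow-negP : ∀ A r G cs → expandRow A r (λ ys → negP (G ys)) cs ≋ negP (expandRow A r G cs)
  expandRow-negP A r G cs = expandRow-linear A r [] (λ _ → []) G cs

  expandRow-zero : ∀ A r {F} → (∀ ys → F ys ≋ []) → ∀ cs → expandRow A r F cs ≋ []
  expandRow-zero A r F≋0 []       = ≋-refl
  expandRow-zero A r F≋0 (c ∷ cs) = ≋-trans
    (-P-cong (*-cong (≋-refl {A r c}) (F≋0 cs)) (expandRow-zero A r (λ ys → F≋0 (c ∷ ys)) cs))
    (annihilate (A r c))
    where
    annihilate : ∀ a → ((a *P []) -P []) ≋ []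
    annihilate = solve-∀ polyRing

  expandRow-zeroRow : ∀ A r F cs → All (λ c → A r c ≋ []) cs → expandRow A r F cs ≋ []
  expandRow-zeroRow A r F []       []            = ≋-refl
  expandRow-zeroRow A r F (c ∷ cs) (Arc≋0 ∷ row≋0) =
    -P-cong (*-cong Arc≋0 (≋-refl {F cs})) (expandRow-zeroRow A r _ cs row≋0)

  minor-zeroColumn : ∀ A c rs → All (λ r → A r c ≋ []) rs → ∀ cs → minor A rs (c ∷ cs) ≋ []
  minor-zeroColumn A c []       []              cs = ≋-refl
  minor-zeroColumn A c (r ∷ rs) (Arc≋0 ∷ col≋0) cs =
    -P-cong (*-cong Arc≋0 (≋-refl {minor A rs cs})) (expandRow-zero A r (minor-zeroColumn A c rs col≋0) cs)

  expandRow-swapRows : ∀ A a b F cs →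
    expandRow A a (expandRow A b F) cs ≋ negP (expandRow A b (expandRow A a F) cs)
  expandRow-swapRows A a b F []       = ≋-refl
  expandRow-swapRows A a b F (c ∷ cs) = begin
    (A a c *P expandRow A b F cs) -P expandRow A a (λ ys → expandRow A b F (c ∷ ys)) cs
      ≈⟨ -P-cong (≋-refl {A a c *P expandRow A b F cs}) (expandRow-linear A a (A b c) F _ cs) ⟩
    (A a c *P expandRow A b F cs) -P ((A b c *P expandRow A a F cs) -P expandRow A a (expandRow A b F′) cs)
      ≈⟨ -P-cong (≋-refl {A a c *P expandRow A b F cs})
                 (-P-cong (≋-refl {A b c *P expandRow A a F cs}) (expandRow-swapRows A a b F′ cs)) ⟩
    (A a c *P expandRow A b F cs) -P ((A b c *P expandRow A a F cs) -P negP (expandRow A b (expandRow A a F′) cs))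
      ≈⟨ swap-terms (A a c) _ (A b c) _ _ ⟩
    negP ((A b c *P expandRow A a F cs) -P ((A a c *P expandRow A b F cs) -P expandRow A b (expandRow A a F′) cs))
      ≈⟨ -‿cong (-P-cong (≋-refl {A b c *P expandRow A a F cs}) (expandRow-linear A b (A a c) F _ cs)) ⟨
    negP ((A b c *P expandRow A a F cs) -P expandRow A b (λ ys → expandRow A a F (c ∷ ys)) cs)
      ∎
    where
    open SetoidReasoning polySetoid
    F′ : List ℕ → Poly
    F′ ys = F (c ∷ ys)
  minor-swapRows : ∀ A ws a b rs cs → minor A (ws ++ a ∷ b ∷ rs) cs ≋ negP (minor A (ws ++ b ∷ a ∷ rs) cs)
  minor-swapRows A []       a b rs cs = expandRow-swapRows A a b (minor A rs) cs
  minor-swapRows A (w ∷ ws) a b rs cs = ≋-trans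
    (expandRow-cong A w (minor-swapRows A ws a b rs) cs)
    (expandRow-negP A w (minor A (ws ++ b ∷ a ∷ rs)) cs)

  expandRow-swapColumns : ∀ A r c d F → (∀ ws ys → F (ws ++ c ∷ d ∷ ys) ≋ negP (F (ws ++ d ∷ c ∷ ys))) →
    ∀ ws cs → expandRow A r F (ws ++ c ∷ d ∷ cs) ≋ negP (expandRow A r F (ws ++ d ∷ c ∷ cs))
  expandRow-swapColumns A r c d F F-alt [] cs = begin
    (A r c *P F (d ∷ cs)) -P ((A r d *P F (c ∷ cs)) -P expandRow A r (λ ys → F (c ∷ d ∷ ys)) cs)
      ≈⟨ -P-cong (≋-refl {A r c *P F (d ∷ cs)}) (-P-cong (≋-refl {A r d *P F (c ∷ cs)})
           (≋-trans (expandRow-cong A r (F-alt []) cs) (expandRow-negP A r (λ ys → F (d ∷ c ∷ ys)) cs))) ⟩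
    (A r c *P F (d ∷ cs)) -P ((A r d *P F (c ∷ cs)) -P negP (expandRow A r (λ ys → F (d ∷ c ∷ ys)) cs))
      ≈⟨ swap-terms (A r c) (F (d ∷ cs)) (A r d) (F (c ∷ cs)) _ ⟩
    negP ((A r d *P F (c ∷ cs)) -P ((A r c *P F (d ∷ cs)) -P expandRow A r (λ ys → F (d ∷ c ∷ ys)) cs))
      ∎
    where
    open SetoidReasoning polySetoid
  expandRow-swapColumns A r c d F F-alt (w ∷ ws) cs = ≋-trans
    (-P-cong (*-cong (≋-refl {A r w}) (F-alt ws cs))
             (expandRow-swapColumns A r c d (λ ys → F (w ∷ ys)) (λ ws′ → F-alt (w ∷ ws′)) ws cs))
    (pull-negP (A r w) (F (ws ++ d ∷ c ∷ cs)) _)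
    where
    pull-negP : ∀ p q z → ((p *P negP q) -P negP z) ≋ negP ((p *P q) -P z)
    pull-negP = solve-∀ polyRing

  minor-swapColumns : ∀ A rs ws c d cs → minor A rs (ws ++ c ∷ d ∷ cs) ≋ negP (minor A rs (ws ++ d ∷ c ∷ cs))
  minor-swapColumns A []       []       c d cs = ≋-refl
  minor-swapColumns A []       (w ∷ ws) c d cs = ≋-refl
  minor-swapColumns A (r ∷ rs) ws       c d cs =
    expandRow-swapColumns A r c d (minor A rs) (λ ws′ → minor-swapColumns A rs ws′ c d) ws cs

  expandRow-map : ∀ A B (P : ℕ → Set) f → (∀ u v → P u → P v → A (f u) (f v) ≋ B u v) →
    ∀ r F G → P r → (∀ ys → All P ys → F (map f ys) ≋ G ys) → ∀ cs → All P cs →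
    expandRow A (f r) F (map f cs) ≋ expandRow B r G cs
  expandRow-map A B P f A≋B r F G Pr F≋G []       []          = ≋-refl
  expandRow-map A B P f A≋B r F G Pr F≋G (c ∷ cs) (Pc ∷ Pcs) =
    -P-cong (*-cong (A≋B r c Pr Pc) (F≋G cs Pcs))
            (expandRow-map A B P f A≋B r (λ ys → F (f c ∷ ys)) (λ ys → G (c ∷ ys)) Pr
                           (λ ys Pys → F≋G (c ∷ ys) (Pc ∷ Pys)) cs Pcs)

  minor-map : ∀ A B (P : ℕ → Set) f → (∀ u v → P u → P v → A (f u) (f v) ≋ B u v) →
    ∀ rs cs → All P rs → All P cs → minor A (map f rs) (map f cs) ≋ minor B rs cs
  minor-map A B P f A≋B []       []       _           _   = ≋-refl
  minor-map A B P f A≋B []       (c ∷ cs) _           _   = ≋-refl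
  minor-map A B P f A≋B (r ∷ rs) cs       (Pr ∷ Prs) Pcs =
    expandRow-map A B P f A≋B r (minor A (map f rs)) (minor B rs) Pr
                  (λ ys Pys → minor-map A B P f A≋B rs ys Prs Pys) cs Pcs

  sumFin-negP : ∀ {n} (f : Fin n → Poly) → sumFin (λ j → negP (f j)) ≋ negP (sumFin f)
  sumFin-negP {zero}  f = ≋-refl
  sumFin-negP {suc n} f =
    ≋-trans (+-cong (≋-refl {negP (f zero)}) (sumFin-negP (λ j → f (suc j)))) (negP-+P (f zero) _)
    where
    negP-+P : ∀ a b → (negP a +P negP b) ≋ negP (a +P b)
    negP-+P = solve-∀ polyRing

  sumFin-expandRow : ∀ A r F m (cs : Fin (suc m) → ℕ) (g : Fin (suc m) → Poly) →
    (∀ j → g j ≋ (A r (cs j) *P F (List.tabulate (cs ∘ punchIn j)))) →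
    sumFin (λ j → alt (toℕ j) (g j)) ≋ expandRow A r F (List.tabulate cs)
  sumFin-expandRow A r F zero    cs g g≋ = ≋-trans (+-cong (g≋ zero) (≋-refl {[]})) (+P-[] _)
    where
    +P-[] : ∀ a → (a +P []) ≋ (a -P [])
    +P-[] = solve-∀ polyRing
  sumFin-expandRow A r F (suc m) cs g g≋ =
    +-cong (g≋ zero)
      (≋-trans (sumFin-negP (λ j → alt (toℕ j) (g (suc j))))
               (-‿cong (sumFin-expandRow A r (λ ys → F (cs zero ∷ ys)) m (cs ∘ suc) (g ∘ suc) (g≋ ∘ suc))))

  det≋minor : ∀ A n (M : Fin n → Fin n → Poly) (rs cs : Fin n → ℕ) → (∀ i j → M i j ≋ A (rs i) (cs j)) →
    det n M ≋ minor A (List.tabulate rs) (List.tabulate cs)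
  det≋minor A zero    M rs cs M≋A = ≋-refl
  det≋minor A (suc n) M rs cs M≋A =
    sumFin-expandRow A (rs zero) (minor A (List.tabulate (rs ∘ suc))) n cs _ λ j →
      *-cong (M≋A zero j)
        (det≋minor A n (λ a b → M (suc a) (punchIn j b)) (rs ∘ suc) (cs ∘ punchIn j) (λ a b → M≋A (suc a) (punchIn j b)))

principalMinor : Matrix → List ℕ → Poly
principalMinor A is = minor A is is

principalMinor-swap : ∀ A ws a b rs →
  principalMinor A (ws ++ a ∷ b ∷ rs) ≋ principalMinor A (ws ++ b ∷ a ∷ rs)
principalMinor-swap A ws a b rs = ≋-trans (minor-swapRows A ws a b rs _)
  (≋-trans (-‿cong (minor-swapColumns A (ws ++ b ∷ a ∷ rs) ws a b rs)) (negP-involutive _))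
  where
  negP-involutive : ∀ p → negP (negP p) ≋ p
  negP-involutive = solve-∀ polyRing

principalMinor-moveFront : ∀ A ws pre x post →
  principalMinor A (ws ++ pre ++ x ∷ post) ≋ principalMinor A (ws ++ x ∷ pre ++ post)
principalMinor-moveFront A ws []        x post = ≋-refl
principalMinor-moveFront A ws (p ∷ pre) x post = ≋-trans
  (subst₂ (λ L M → principalMinor A L ≋ principalMinor A M)
          (++-assoc ws (p ∷ []) (pre ++ x ∷ post)) (++-assoc ws (p ∷ []) (x ∷ pre ++ post))
          (principalMinor-moveFront A (ws ++ p ∷ []) pre x post))
  (principalMinor-swap A ws p x (pre ++ post))

opaque
  unfolding minor

  principalMinor-pendant : ∀ A u w R → All (λ c → A u c ≋ []) R → All (λ c → A c u ≋ []) R →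
    principalMinor A (u ∷ w ∷ R) ≋
      ((A u u *P principalMinor A (w ∷ R)) -P (A u w *P (A w u *P principalMinor A R)))
  principalMinor-pendant A u w R row≋0 col≋0 =
    -P-cong (≋-refl {A u u *P principalMinor A (w ∷ R)})
      (≋-trans (-P-cong (*-cong (≋-refl {A u w}) minor-without-u)
                        (expandRow-zeroRow A u (λ ys → minor A (w ∷ R) (u ∷ w ∷ ys)) R row≋0))
               (-P-identityʳ _))
    where
    -P-identityʳ : ∀ a → (a -P []) ≋ a
    -P-identityʳ = solve-∀ polyRing
    minor-without-u : minor A (w ∷ R) (u ∷ R) ≋ (A w u *P principalMinor A R)
    minor-without-u = ≋-trans
      (-P-cong (≋-refl {A w u *P principalMinor A R}) (expandRow-zero A w (minor-zeroColumn A u R col≋0) R))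
      (-P-identityʳ _)

PendantEdge : Matrix → ℕ → ℕ → Set
PendantEdge A u w = A u u ≡ X × A u w ≡ negP oneP × A w u ≡ negP oneP

principalMinor-deletePendant : ∀ A u w R → PendantEdge A u w →
  All (λ c → A u c ≋ []) R → All (λ c → A c u ≋ []) R →
  principalMinor A (u ∷ w ∷ R) ≋ step (principalMinor A (w ∷ R)) (principalMinor A R)
principalMinor-deletePendant A u w R (diagonal , toNeighbour , fromNeighbour) row≋0 col≋0 =
  ≋-trans (principalMinor-pendant A u w R row≋0 col≋0) (begin
    (A u u *P principalMinor A (w ∷ R)) -P (A u w *P (A w u *P principalMinor A R))
      ≈⟨ -P-cong (*-cong (≡⇒≋ diagonal) ≋-refl) (*-cong (≡⇒≋ toNeighbour) (*-cong (≡⇒≋ fromNeighbour) ≋-refl)) ⟩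
    (X *P principalMinor A (w ∷ R)) -P (negP oneP *P (negP oneP *P principalMinor A R))
      ≈⟨ sign-cancels (principalMinor A (w ∷ R)) (principalMinor A R) ⟩
    (X *P principalMinor A (w ∷ R)) -P principalMinor A R
      ∎)
  where
  open SetoidReasoning polySetoid
  sign-cancels : ∀ p q → ((X *P p) -P (negP oneP *P (negP oneP *P q))) ≋ ((X *P p) -P q)
  sign-cancels = solve-∀ polyRing

-- charMatrix r m u v is the (u, v) entry of λI − A(P_{2,2;r}^{2,m}), extended to all of ℕ.
charMatrix : ℕ → ℕ → Matrix
charMatrix r m u v = (if u ≡ᵇ v then X else []) -P constP (edgeB 2 2 r 2 m u v ∨ edgeB 2 2 r 2 m v u)

data Edge (r m : ℕ) : ℕ → ℕ → Set where
  spine   : ∀ u → suc u < r → Edge r m u (suc u)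
  attach₁ : Edge r m 2 r
  arm₁    : Edge r m r (suc r)
  attach₂ : Edge r m m (2 + r)
  arm₂    : Edge r m (2 + r) (3 + r)

squeeze : ∀ {a v} → a < v → v < a + 2 → v ≡ suc a
squeeze {a} {v} a<v v<a+2 = ≤-antisym (s≤s⁻¹ (subst (v <_) (+-comm a 2) v<a+2)) a<v

T-∨⁻ : ∀ x {y} → T (x ∨ y) → T x ⊎ T y
T-∨⁻ x = Equivalence.to (T-∨ {x})

T-∧⁻ : ∀ x {y} → T (x ∧ y) → T x × T y
T-∧⁻ x = Equivalence.to (T-∧ {x})

module _ {r m u v : ℕ} where

  spine-sound : T ((suc u ≡ᵇ v) ∧ (v <ᵇ r)) → Edge r m u v
  spine-sound e with T-∧⁻ (suc u ≡ᵇ v) e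
  ... | su≡v , v<r with ≡ᵇ⇒≡ (suc u) v su≡v
  ...   | refl = spine u (<ᵇ⇒< (suc u) r v<r)

  attach₁-sound : T ((u ≡ᵇ 2) ∧ (v ≡ᵇ r)) → Edge r m u v
  attach₁-sound e with T-∧⁻ (u ≡ᵇ 2) e
  ... | u≡2 , v≡r with ≡ᵇ⇒≡ u 2 u≡2 | ≡ᵇ⇒≡ v r v≡r
  ...   | refl | refl = attach₁

  arm₁-sound : T ((suc u ≡ᵇ v) ∧ (r <ᵇ v) ∧ (v <ᵇ r + 2)) → Edge r m u v
  arm₁-sound e with T-∧⁻ (suc u ≡ᵇ v) e
  ... | su≡v , bounds with T-∧⁻ (r <ᵇ v) bounds | ≡ᵇ⇒≡ (suc u) v su≡v
  ...   | r<v , v<r+2 | refl with squeeze (<ᵇ⇒< r v r<v) (<ᵇ⇒< v (r + 2) v<r+2)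
  ...     | refl = arm₁

  attach₂-sound : T ((u ≡ᵇ m) ∧ (v ≡ᵇ r + 2)) → Edge r m u v
  attach₂-sound e with T-∧⁻ (u ≡ᵇ m) e
  ... | u≡m , v≡r+2 with ≡ᵇ⇒≡ u m u≡m | trans (≡ᵇ⇒≡ v (r + 2) v≡r+2) (+-comm r 2)
  ...   | refl | refl = attach₂

  arm₂-sound : T ((suc u ≡ᵇ v) ∧ (r + 2 <ᵇ v) ∧ (v <ᵇ r + 2 + 2)) → Edge r m u v
  arm₂-sound e with T-∧⁻ (suc u ≡ᵇ v) e
  ... | su≡v , bounds with T-∧⁻ (r + 2 <ᵇ v) bounds | ≡ᵇ⇒≡ (suc u) v su≡v
  ...   | r+2<v , v<r+4 | refl
          with trans (squeeze (<ᵇ⇒< (r + 2) v r+2<v) (<ᵇ⇒< v (r + 2 + 2) v<r+4)) (cong suc (+-comm r 2))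
  ...     | refl = arm₂

edgeB-sound : ∀ r m u v → T (edgeB 2 2 r 2 m u v) → Edge r m u v
edgeB-sound r m u v e with T-∨⁻ _ e
... | inj₁ e = spine-sound e
... | inj₂ e with T-∨⁻ _ e
...   | inj₁ e = attach₁-sound e
...   | inj₂ e with T-∨⁻ _ e
...     | inj₁ e = arm₁-sound e
...     | inj₂ e with T-∨⁻ _ e
...       | inj₁ e = attach₂-sound e
...       | inj₂ e = arm₂-sound e

charMatrix-offEdge : ∀ r m u v → u ≢ v → ¬ Edge r m u v → ¬ Edge r m v u → charMatrix r m u v ≡ []
charMatrix-offEdge r m u v u≢v ¬uv ¬vu
  with u ≡ᵇ v in eq | edgeB 2 2 r 2 m u v in uv | edgeB 2 2 r 2 m v u in vu
... | true  | _     | _     = ⊥-elim (u≢v (≡ᵇ⇒≡ u v (subst T (sym eq) tt)))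
... | false | true  | _     = ⊥-elim (¬uv (edgeB-sound r m u v (subst T (sym uv) tt)))
... | false | false | true  = ⊥-elim (¬vu (edgeB-sound r m v u (subst T (sym vu) tt)))
... | false | false | false = refl

≡ᵇ-comm : ∀ u v → (u ≡ᵇ v) ≡ (v ≡ᵇ u)
≡ᵇ-comm zero    zero    = refl
≡ᵇ-comm zero    (suc v) = refl
≡ᵇ-comm (suc u) zero    = refl
≡ᵇ-comm (suc u) (suc v) = ≡ᵇ-comm u v

charMatrix-sym : ∀ r m u v → charMatrix r m u v ≡ charMatrix r m v u
charMatrix-sym r m u v =
  cong₂ (λ b e → (if b then X else []) -P constP e) (≡ᵇ-comm u v) (∨-comm (edgeB 2 2 r 2 m u v) _)

charMatrix-deletePendant : ∀ r m u w R → PendantEdge (charMatrix r m) u w →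
  All (λ c → charMatrix r m u c ≡ []) R →
  principalMinor (charMatrix r m) (u ∷ w ∷ R) ≋
    step (principalMinor (charMatrix r m) (w ∷ R)) (principalMinor (charMatrix r m) R)
charMatrix-deletePendant r m u w R pendant row≡0 =
  principalMinor-deletePendant (charMatrix r m) u w R pendant
    (All.map ≡⇒≋ row≡0) (All.map (λ {c} e → ≡⇒≋ (trans (charMatrix-sym r m c u) e)) row≡0)

-- Increasing r and m by one moves every vertex ≥ 3, and every edge among such vertices, up by one.
principalMinor-shift : ∀ r m {L L′} → map suc L ≡ L′ → All (3 ≤_) L →
  principalMinor (charMatrix (suc r) (suc m)) L′ ≋ principalMinor (charMatrix r m) L
principalMinor-shift r m {L} refl 3≤L = minor-map (charMatrix (suc r) (suc m)) (charMatrix r m) (3 ≤_) suc shift L L 3≤L 3≤L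
  where
  shift : ∀ u v → 3 ≤ u → 3 ≤ v → charMatrix (suc r) (suc m) (suc u) (suc v) ≋ charMatrix r m u v
  shift (suc (suc (suc u))) (suc (suc (suc v))) (s≤s (s≤s (s≤s _))) (s≤s (s≤s (s≤s _))) = ≋-refl

does-≟ : ∀ {n} (i j : Fin n) → does (i ≟ j) ≡ (toℕ i ≡ᵇ toℕ j)
does-≟ zero    zero    = refl
does-≟ zero    (suc j) = refl
does-≟ (suc i) zero    = refl
does-≟ (suc i) (suc j) = does-≟ i j

tabulate-toℕ : ∀ {A : Set} n (f : ℕ → A) → List.tabulate (f ∘ toℕ {n}) ≡ applyUpTo f n
tabulate-toℕ zero    f = refl
tabulate-toℕ (suc n) f = cong (f 0 ∷_) (tabulate-toℕ n (f ∘ suc))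

φ-H≋principalMinor : ∀ n → φ (H n) ≋ principalMinor (charMatrix (n ∸ 4) (n ∸ 7)) (upTo (Graph.size (H n)))
φ-H≋principalMinor n =
  subst (λ L → φ (H n) ≋ principalMinor (charMatrix (n ∸ 4) (n ∸ 7)) L) (tabulate-toℕ (Graph.size (H n)) id)
    (det≋minor (charMatrix (n ∸ 4) (n ∸ 7)) (Graph.size (H n)) (charMat (H n)) toℕ toℕ λ i j →
      ≡⇒≋ (cong (λ b → (if b then X else []) -P constP (Graph.adj (H n) i j)) (does-≟ i j)))

map-suc-applyUpTo-++ : ∀ a k L → map suc (applyUpTo (a +_) k ++ L) ≡ applyUpTo (suc a +_) k ++ map suc L
map-suc-applyUpTo-++ a k L = trans (map-++ suc (applyUpTo (a +_) k) L) (cong (_++ map suc L) (map-applyUpTo (a +_) suc k))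

-- tailPoly extra t is φ of the subgraph of P_{2,2;5+t}^{2,2+t} induced on {3, …, 4+t} ∪ extra t.
tailPoly : (ℕ → List ℕ) → ℕ → Poly
tailPoly extra t = principalMinor (charMatrix (5 + t) (2 + t)) (applyUpTo (3 +_) (2 + t) ++ extra t)

pendant₃₄ : ∀ t → PendantEdge (charMatrix (7 + t) (4 + t)) 3 4
pendant₃₄ zero    = refl , refl , refl
pendant₃₄ (suc t) = refl , refl , refl

tailPoly-recurrent : ∀ extra → (∀ t → map suc (extra t) ≡ extra (suc t)) → (∀ t → All (5 ≤_) (extra t)) →
  Recurrent (tailPoly extra)
tailPoly-recurrent extra extra-shift extra≥5 t = begin
  principalMinor A (3 ∷ 4 ∷ S)
    ≈⟨ charMatrix-deletePendant (7 + t) (4 + t) 3 4 S (pendant₃₄ t) (All.map row₃≡0 5≤S) ⟩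
  step (principalMinor A (4 ∷ S)) (principalMinor A S)
    ≈⟨ step-cong (shift (6 + t) (3 + t) 0 (3 + t) (1 + t))
                 (≋-trans (shift (6 + t) (3 + t) 1 (2 + t) (1 + t)) (shift (5 + t) (2 + t) 0 (2 + t) t)) ⟩
  step (tailPoly extra (1 + t)) (tailPoly extra t)
    ∎
  where
  open SetoidReasoning polySetoid
  A : Matrix
  A = charMatrix (7 + t) (4 + t)
  S : List ℕ
  S = applyUpTo (5 +_) (2 + t) ++ extra (2 + t)
  row₃≡0 : ∀ {c} → 5 ≤ c → A 3 c ≡ []
  row₃≡0 (s≤s (s≤s (s≤s (s≤s (s≤s {n = c} _))))) = charMatrix-offEdge (7 + t) (4 + t) 3 (5 + c) (λ ()) (λ ()) (λ ())
  5≤S : All (5 ≤_) S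
  5≤S = ++⁺ (applyUpTo⁺₂ (5 +_) (2 + t) (m≤m+n 5)) (extra≥5 (2 + t))
  shift : ∀ r m a k s →
    principalMinor (charMatrix (suc r) (suc m)) (applyUpTo ((4 + a) +_) k ++ extra (suc s)) ≋
    principalMinor (charMatrix r m) (applyUpTo ((3 + a) +_) k ++ extra s)
  shift r m a k s = principalMinor-shift r m
    (trans (map-suc-applyUpTo-++ (3 + a) k (extra s)) (cong (applyUpTo ((4 + a) +_) k ++_) (extra-shift s)))
    (++⁺ (applyUpTo⁺₂ ((3 + a) +_) k (λ i → ≤-trans (m≤m+n 3 a) (m≤m+n (3 + a) i)))
         (All.map (≤-trans (m≤m+n 3 2)) (extra≥5 s)))

armVertices edgeArmVertices : ℕ → List ℕ
armVertices t = (7 + t) ∷ (8 + t) ∷ []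
edgeArmVertices t = (5 + t) ∷ (6 + t) ∷ armVertices t

arm-recurrent : Recurrent (tailPoly armVertices)
arm-recurrent = tailPoly-recurrent armVertices (λ _ → refl) λ t → m≤m+n 5 (2 + t) ∷ m≤m+n 5 (3 + t) ∷ []

edgeArm-recurrent : Recurrent (tailPoly edgeArmVertices)
edgeArm-recurrent = tailPoly-recurrent edgeArmVertices (λ _ → refl) λ t →
  m≤m+n 5 t ∷ m≤m+n 5 (1 + t) ∷ m≤m+n 5 (2 + t) ∷ m≤m+n 5 (3 + t) ∷ []

-- Deleting the pendant vertices 0, 1, 7+t, 6+t, 2 of H_{10+t} in turn: d₁ t, d₂ t, e₁ t, e₂ t
-- are φ of H_{10+t} minus {0}, {0,1}, {0,1,7+t}, {0,1,6+t,7+t}, and f, d are the tail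
-- polynomials that remain.
module PendantExpansion (f d : ℕ → Poly) where

  e₂ e₁ d₂ d₁ expansion : ℕ → Poly
  e₂ t = step (f (1 + t)) (f t)
  e₁ t = step (e₂ t) (f (1 + t))
  d₂ t = step (e₁ t) (e₂ t)
  d₁ t = step (d₂ t) (d (1 + t))
  expansion t = step (d₁ t) (d₂ t)

  expansion-recurrent : Recurrent f → Recurrent d → Recurrent expansion
  expansion-recurrent rec-f rec-d = Recurrent-step d₁ d₂ rec-d₁ rec-d₂
    where
    rec-e₂ : Recurrent e₂
    rec-e₂ = Recurrent-step (f ∘ suc) f (Recurrent-suc f rec-f) rec-f
    rec-e₁ : Recurrent e₁
    rec-e₁ = Recurrent-step e₂ (f ∘ suc) rec-e₂ (Recurrent-suc f rec-f)
    rec-d₂ : Recurrent d₂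
    rec-d₂ = Recurrent-step e₁ e₂ rec-e₁ rec-e₂
    rec-d₁ : Recurrent d₁
    rec-d₁ = Recurrent-step d₂ (d ∘ suc) rec-d₂ (Recurrent-suc d rec-d)

applyUpTo-+ : ∀ {A : Set} (f : ℕ → A) k n → applyUpTo f (k + n) ≡ applyUpTo f n ++ applyUpTo (f ∘ (_+ n)) k
applyUpTo-+ f zero    n = sym (++-identityʳ (applyUpTo f n))
applyUpTo-+ f (suc k) n = begin
  applyUpTo f (suc (k + n))                                     ≡⟨ applyUpTo-∷ʳ f (k + n) ⟨
  applyUpTo f (k + n) ∷ʳ f (k + n)                              ≡⟨ cong (_∷ʳ f (k + n)) (applyUpTo-+ f k n) ⟩
  (applyUpTo f n ++ applyUpTo (f ∘ (_+ n)) k) ∷ʳ f (k + n)      ≡⟨ ++-assoc (applyUpTo f n) _ _ ⟩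
  applyUpTo f n ++ (applyUpTo (f ∘ (_+ n)) k ∷ʳ f (k + n))      ≡⟨ cong (applyUpTo f n ++_) (applyUpTo-∷ʳ (f ∘ (_+ n)) k) ⟩
  applyUpTo f n ++ applyUpTo (f ∘ (_+ n)) (suc k)               ∎
  where open ≡-Reasoning

-- The entries at level suc t reduce to those at level t.
pendant₇₆ : ∀ t → PendantEdge (charMatrix (6 + t) (3 + t)) (7 + t) (6 + t)
pendant₇₆ zero    = refl , refl , refl
pendant₇₆ (suc t) = pendant₇₆ t

pendant₆₂ : ∀ t → PendantEdge (charMatrix (6 + t) (3 + t)) (6 + t) 2
pendant₆₂ zero    = refl , refl , refl
pendant₆₂ (suc t) = pendant₆₂ t

pendant₂₃ : ∀ t → PendantEdge (charMatrix (6 + t) (3 + t)) 2 3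
pendant₂₃ zero    = refl , refl , refl
pendant₂₃ (suc t) = refl , refl , refl

-- H_{10+t} has spine 0, …, 5+t, the pendant path 6+t, 7+t at 2 and the pendant path 8+t, 9+t at 3+t.
module H₁₀ (t : ℕ) where

  A : Matrix
  A = charMatrix (6 + t) (3 + t)

  mid R₃ R₄ Q : List ℕ
  mid = applyUpTo (3 +_) (3 + t)
  R₃ = mid ++ (8 + t) ∷ (9 + t) ∷ []
  R₄ = applyUpTo (4 +_) (2 + t) ++ (8 + t) ∷ (9 + t) ∷ []
  Q = (6 + t) ∷ (7 + t) ∷ (8 + t) ∷ (9 + t) ∷ []

  offEdge : ∀ u v → u ≢ v → ¬ Edge (6 + t) (3 + t) u v → ¬ Edge (6 + t) (3 + t) v u → A u v ≡ []
  offEdge = charMatrix-offEdge (6 + t) (3 + t)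

  row₀ : All (λ c → A 0 c ≡ []) (2 ∷ mid ++ Q)
  row₀ = zero₀ 0 ∷ ++⁺ (applyUpTo⁺₂ (3 +_) (3 + t) (zero₀ ∘ suc))
                      (zero₀ (4 + t) ∷ zero₀ (5 + t) ∷ zero₀ (6 + t) ∷ zero₀ (7 + t) ∷ [])
    where
    zero₀ : ∀ c → A 0 (2 + c) ≡ []
    zero₀ c = offEdge 0 (2 + c) (λ ()) (λ ()) (λ ())

  row₁ : All (λ c → A 1 c ≡ []) (mid ++ Q)
  row₁ = ++⁺ (applyUpTo⁺₂ (3 +_) (3 + t) zero₁)
             (zero₁ (3 + t) ∷ zero₁ (4 + t) ∷ zero₁ (5 + t) ∷ zero₁ (6 + t) ∷ [])
    where
    zero₁ : ∀ c → A 1 (3 + c) ≡ []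
    zero₁ c = offEdge 1 (3 + c) (λ ()) (λ ()) (λ ())

  row₇ : All (λ c → A (7 + t) c ≡ []) (2 ∷ R₃)
  row₇ = offEdge (7 + t) 2 (λ ()) (λ ()) (λ ())
       ∷ ++⁺ (applyUpTo⁺₁ (3 +_) (3 + t) λ {i} i<3+t →
               offEdge (7 + t) (3 + i) (λ { refl → m+n≮n 1 (3 + t) i<3+t })
                                 (λ { (spine _ _) → m+n≮n 2 (3 + t) i<3+t })
                                 (λ { (spine _ _) → n≮n (3 + t) i<3+t ; arm₁ → n≮n (3 + t) i<3+t }))
             ( offEdge (7 + t) (8 + t) (λ ()) (λ { (spine _ 8+t<6+t) → m+n≮n 2 (6 + t) 8+t<6+t }) (λ ())
             ∷ offEdge (7 + t) (9 + t) (λ ()) (λ ()) (λ ()) ∷ [])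

  row₆ : All (λ c → A (6 + t) c ≡ []) R₃
  row₆ = ++⁺ (applyUpTo⁺₁ (3 +_) (3 + t) λ {i} i<3+t →
               offEdge (6 + t) (3 + i) (λ { refl → n≮n (3 + t) i<3+t })
                                 (λ { (spine _ _) → m+n≮n 1 (3 + t) i<3+t ; arm₁ → m+n≮n 1 (3 + t) i<3+t })
                                 (λ { (spine _ 6+t<6+t) → n≮n (6 + t) 6+t<6+t }))
             (offEdge (6 + t) (8 + t) (λ ()) (λ ()) (λ ()) ∷ offEdge (6 + t) (9 + t) (λ ()) (λ ()) (λ ()) ∷ [])

  row₂ : All (λ c → A 2 c ≡ []) R₄
  row₂ = ++⁺ (applyUpTo⁺₁ (4 +_) (2 + t) λ {i} i<2+t →
               offEdge 2 (4 + i) (λ ()) (λ { attach₁ → n≮n (2 + t) i<2+t }) (λ ()))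
             (offEdge 2 (8 + t) (λ ()) (λ ()) (λ ()) ∷ offEdge 2 (9 + t) (λ ()) (λ ()) (λ ()) ∷ [])

  open PendantExpansion (tailPoly armVertices) (tailPoly edgeArmVertices)

  M : List ℕ → Poly
  M = principalMinor A

  deletePendant : ∀ u w R → PendantEdge A u w → All (λ c → A u c ≡ []) R →
    M (u ∷ w ∷ R) ≋ step (M (w ∷ R)) (M R)
  deletePendant = charMatrix-deletePendant (6 + t) (3 + t)

  vertices : upTo (Graph.size (H (10 + t))) ≡ 0 ∷ 1 ∷ 2 ∷ mid ++ Q
  vertices = trans (cong upTo (trans (+-assoc (6 + t) 2 2) (+-comm (6 + t) 4))) (applyUpTo-+ id 4 (6 + t))

  M≋e₂ : M (2 ∷ R₃) ≋ e₂ t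
  M≋e₂ = ≋-trans (deletePendant 2 3 R₄ (pendant₂₃ t) row₂)
    (step-cong ≋-refl (principalMinor-shift (5 + t) (2 + t) (map-suc-applyUpTo-++ 3 (2 + t) (armVertices t))
                         (++⁺ (applyUpTo⁺₂ (3 +_) (2 + t) (m≤m+n 3)) (m≤m+n 3 (4 + t) ∷ m≤m+n 3 (5 + t) ∷ []))))

  M≋e₁ : M ((6 + t) ∷ 2 ∷ R₃) ≋ e₁ t
  M≋e₁ = ≋-trans (deletePendant (6 + t) 2 R₃ (pendant₆₂ t) row₆) (step-cong M≋e₂ ≋-refl)

  M≋d₂ : M (2 ∷ mid ++ Q) ≋ d₂ t
  M≋d₂ = begin
    M (2 ∷ mid ++ Q)
      ≈⟨ principalMinor-moveFront A [] (2 ∷ mid) (6 + t) ((7 + t) ∷ (8 + t) ∷ (9 + t) ∷ []) ⟩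
    M ((6 + t) ∷ 2 ∷ mid ++ (7 + t) ∷ (8 + t) ∷ (9 + t) ∷ [])
      ≈⟨ principalMinor-moveFront A [] ((6 + t) ∷ 2 ∷ mid) (7 + t) ((8 + t) ∷ (9 + t) ∷ []) ⟩
    M ((7 + t) ∷ (6 + t) ∷ 2 ∷ R₃)
      ≈⟨ deletePendant (7 + t) (6 + t) (2 ∷ R₃) (pendant₇₆ t) row₇ ⟩
    step (M ((6 + t) ∷ 2 ∷ R₃)) (M (2 ∷ R₃))
      ≈⟨ step-cong M≋e₁ M≋e₂ ⟩
    d₂ t
      ∎
    where open SetoidReasoning polySetoid

  φ-H₁₀ : φ (H (10 + t)) ≋ expansion t
  φ-H₁₀ = begin
    φ (H (10 + t))
      ≈⟨ φ-H≋principalMinor (10 + t) ⟩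
    M (upTo (Graph.size (H (10 + t))))
      ≡⟨ cong M vertices ⟩
    M (0 ∷ 1 ∷ 2 ∷ mid ++ Q)
      ≈⟨ deletePendant 0 1 (2 ∷ mid ++ Q) pendant₀₁ row₀ ⟩
    step (M (1 ∷ 2 ∷ mid ++ Q)) (M (2 ∷ mid ++ Q))
      ≈⟨ step-cong (deletePendant 1 2 (mid ++ Q) pendant₁₂ row₁) ≋-refl ⟩
    step (step (M (2 ∷ mid ++ Q)) (M (mid ++ Q))) (M (2 ∷ mid ++ Q))
      ≈⟨ step-cong (step-cong M≋d₂ ≋-refl) M≋d₂ ⟩
    expansion t
      ∎
    where
    open SetoidReasoning polySetoid
    pendant₀₁ : PendantEdge A 0 1
    pendant₀₁ = refl , refl , refl
    pendant₁₂ : PendantEdge A 1 2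
    pendant₁₂ = refl , refl , refl

φ-H-recurrent : Recurrent (λ t → φ (H (10 + t)))
φ-H-recurrent t = ≋-trans (H₁₀.φ-H₁₀ (2 + t)) (≋-trans
  (PendantExpansion.expansion-recurrent (tailPoly armVertices) (tailPoly edgeArmVertices) arm-recurrent edgeArm-recurrent t)
  (≋-sym (step-cong (H₁₀.φ-H₁₀ (1 + t)) (H₁₀.φ-H₁₀ t))))

proposition3p5 : ∀ (n : ℕ) → 12 ≤ n →
    φ (H n) ≈P (X *P φ (H (n ∸ 1)) -P φ (H (n ∸ 2)))
proposition3p5 n 12≤n =
  let t , 12+t≡n = m≤n⇒∃[o]m+o≡n 12≤n in
  subst (λ n → φ (H n) ≈P (X *P φ (H (n ∸ 1)) -P φ (H (n ∸ 2)))) 12+t≡n (un≋ (φ-H-recurrent t))
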